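{- Let $B\in\Gamma^*$ have length at most $n$ and let $\ell\in\{0,\dots,L\}$. Let $(B_0,B_1,\dots,B_s)=\mathrm{Split}(B,\ell)$, where $H_\ell:\Gamma^2\to\{0,1\}$ is chosen to be a random $(D,5\log n)$-iterated pairwise independent function. Then with probability at least $1-1/n^3$, $|\mathrm{Dict}(B_j)|\le 5D\log n$ for all $j\in\{0,\dots,s\}$.
   Context: $\Gamma$ is a finite alphabet, $D\ge1$ an integer, logs base 2. For a string $w$, $\mathrm{Dict}(w)=\{w[i]w[i+1]: 1\le i\le|w|-1\}$, $w[p,q)=w_p\cdots w_{q-1}$. A family of functions $U\to V$ is pairwise independent if for $u\ne u'$ and any $v,v'$, $\Pr_h[h(u)=v\wedge h(u')=v']=1/|V|^2$. A $(D,m)$-iterated pairwise independent function $H:\Gamma^2\to\{0,1\}$ is obtained by drawing independently $h_1,\dots,h_m:\Gamma^2\to\{0,\dots,mD-1\}$ uniformly from a pairwise independent family and setting $H(ab)=0$ iff $\prod_ih_i(ab)=0$. $\mathrm{Split}(B,\ell)$: let $i_1<\dots<i_s$ be all $i\in\{2,\dots,|B|-1\}$ with $H_\ell(B[i]B[i+1])=0$, $i_0=1$, $i_{s+1}=|B|+1$; return $(B[i_0,i_1),\dots,B[i_s,i_{s+1}))$. -}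

module Defs where

open import Data.Nat using (ℕ; zero; suc; _+_; _*_; _∸_; _^_; _≤_; _≟_)
open import Data.Nat.Properties using ()
open import Data.Fin using (Fin; toℕ)
import Data.Fin.Properties as FinP
open import Data.Product using (_×_; _,_; proj₁; proj₂)
open import Data.Product.Properties using (≡-dec)
open import Data.List using (List; []; _∷_; _++_; [_]; length; map; filter; zip; drop; take; concatMap; upTo)
open import Data.List.Relation.Unary.All using (All)
open import Data.Nat.ListAction using (product)
open import Relation.Binary.PropositionalEquality using (_≡_; _≢_)
open import Relation.Nullary using (Dec; yes; no)
open import Relation.Nullary.Decidable using (_×-dec_)

-- The alphabet Γ is Fin g (an arbitrary finite alphabet of size g).
Pair : ℕ → Set
Pair g = Fin g × Fin g

_≟P_ : ∀ {g} → (x y : Pair g) → Dec (x ≡ y)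
_≟P_ = ≡-dec FinP._≟_ FinP._≟_

-- Substring w[p,q) = w_p ⋯ w_{q-1}  (1-based positions)
sub : ∀ {A : Set} → List A → ℕ → ℕ → List A
sub w p q = take (q ∸ p) (drop (p ∸ 1) w)

pairs : ∀ {A : Set} → List A → List (A × A)
pairs w = zip w (drop 1 w)

-- Dict(w) as a duplicate-free list; |Dict(w)| is its length.
Dict : ∀ {g} → List (Fin g) → List (Pair g)
Dict w = Data.List.deduplicate _≟P_ (pairs w)

count : ∀ {A : Set} {P : A → Set} → ((x : A) → Dec (P x)) → List A → ℕ
count P? xs = length (filter P? xs)

-- A list F of functions U → Fin r (a multiset; uniform draw = uniform index)
-- is pairwise independent: for u ≠ u' and any v, v',
--   #{h ∈ F : h u = v ∧ h u' = v'} / |F| = 1 / r² .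
PairwiseIndependent : ∀ {g r} → List (Pair g → Fin r) → Set
PairwiseIndependent {g} {r} F =
  (u u' : Pair g) → u ≢ u' → (v v' : Fin r) →
  count (λ h → (h u FinP.≟ v) ×-dec (h u' FinP.≟ v')) F * (r * r) ≡ length F

-- All m-tuples of elements of F (with multiplicity): the sample space of
-- m independent uniform draws from F.
tuples : ∀ {A : Set} → List A → ℕ → List (List A)
tuples F zero = [] ∷ []
tuples F (suc m) = concatMap (λ h → map (h ∷_) (tuples F m)) F

-- The iterated function H built from h₁,…,h_m : H(ab) = 0 iff ∏ h_i(ab) = 0.
-- We represent H by its zero-test.
HZero : ∀ {g r} → List (Pair g → Fin r) → Pair g → Set
HZero hs ab = product (map (λ h → toℕ (h ab)) hs) ≡ 0

HZero? : ∀ {g r} (hs : List (Pair g → Fin r)) (ab : Pair g) → Dec (HZero hs ab)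
HZero? hs ab = product (map (λ h → toℕ (h ab)) hs) ≟ 0

-- Indices i ∈ {2,…,|B|-1} with H(B[i]B[i+1]) = 0, in increasing order.
-- (pairs B is indexed by 1,…,|B|-1; dropping its first entry gives 2,…,|B|-1.)
cutPoints : ∀ {g r : ℕ} → List (Pair g → Fin r) → List (Fin g) → List ℕ
cutPoints {g} hs B = go 2 (drop 1 (pairs B))
  where
  go : ℕ → List (Pair g) → List ℕ
  go i [] = []
  go i (ab ∷ rest) with HZero? hs ab
  ... | yes _ = i ∷ go (suc i) rest
  ... | no _  = go (suc i) rest

slices : ∀ {A : Set} → List A → List ℕ → List (List A)
slices B [] = []
slices B (p ∷ []) = []
slices B (p ∷ q ∷ rest) = sub B p q ∷ slices B (q ∷ rest)

Split : ∀ {g r} → List (Pair g → Fin r) → List (Fin g) → List (List (Fin g))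
Split hs B = slices B (1 ∷ cutPoints hs B ++ [ suc (length B) ])

{-# OPTIONS --safe #-}
module Submission where

open import Data.Nat using (ℕ; zero; suc; _+_; _*_; _∸_; _^_; _≤_; _<_; _≥_; z≤n; s≤s; s≤s⁻¹; ⌈_/2⌉)
open import Data.Nat.Properties hiding (_≟_)
open import Data.Nat.Logarithm using (⌈log₂_⌉)
open import Data.Nat.Logarithm.Core using (⌈log2⌉)
open import Data.Nat.Induction using (<-wellFounded)
open import Data.Nat.Solver using (module +-*-Solver)
open import Induction.WellFounded using (Acc; acc)
open import Data.Fin using (Fin; toℕ; _≟_) renaming (zero to 0F)
open import Data.Fin.Properties using (toℕ<n)
open import Data.List using (List; []; _∷_; _++_; [_]; length; map; filter; concatMap; take; drop; deduplicate; upTo; allFin; cartesianProduct)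
open import Data.List.Properties
  using (++-assoc; ++-identityʳ; length-++; length-map; length-take; length-drop; length-filter; length-upTo; length-tabulate; drop-drop; drop-all; take-all)
open import Data.List.Relation.Unary.All as All using (All; []; _∷_; all?; lookup; tabulate)
open import Data.List.Relation.Unary.All.Properties using (take⁺; ++⁺; deduplicate⁺; ¬All⇒Any¬)
open import Data.List.Relation.Unary.Any using (Any; here; there)
open import Data.List.Relation.Unary.AllPairs using (_∷_)
open import Data.List.Membership.Propositional using (_∈_; lose)
open import Data.List.Membership.Propositional.Properties using (∈-allFin; ∈-upTo⁺; ∈-cartesianProduct⁺)
open import Data.List.Relation.Unary.Unique.Propositional using (Unique)
import Data.List.Relation.Unary.Unique.Propositional.Properties as Unique
import Data.List.Relation.Unary.Unique.DecPropositional.Properties as UniqueDec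
open import Data.Product using (∃; ∃₂; _×_; _,_; proj₂)
open import Function using (_∘_)
open import Relation.Nullary using (Dec; yes; no; ¬_; ¬?; contradiction)
open import Relation.Nullary.Decidable using (_×-dec_)
open import Relation.Binary.Definitions using (DecidableEquality)
open import Relation.Binary.PropositionalEquality hiding ([_])
open import Algebra.Properties.CommutativeSemigroup +-commutativeSemigroup
  using () renaming (interchange to +-interchange; x∙yz≈y∙xz to x+[y+z]≡y+[x+z]; xy∙z≈x∙zy to [x+y]+z≡x+[z+y])
open import Algebra.Properties.CommutativeSemigroup *-commutativeSemigroup
  using () renaming (interchange to *-interchange; x∙yz≈y∙xz to x*[y*z]≡y*[x*z])
open +-*-Solver using (solve; _:+_; _:*_; _:^_; _:=_; con)
open import Defs

-- If some block of Split(B) has more than K ≥ r distinct pairs, then some window of consecutive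
-- pairs of B holds r distinct pairs on none of which H vanishes, i.e. on which every hᵢ is nonzero.
-- For a fixed set S of r pairs and one pairwise independent h into {0,…,r−1}, the number Z of zeros
-- of h on S has E Z = 1 and E Z² ≤ 2, so the pointwise bound 3Z + 2[Z = 0] ≤ 2 + Z² gives
-- Pr[Z = 0] ≤ 1/2. The m = 5⌈log n⌉ functions are drawn independently, so a fixed window survives
-- with probability at most 2⁻ᵐ ≤ n⁻⁵, and a union bound over the n² windows leaves n⁻³.
-- Probabilities are counts over the list of m-tuples drawn from F.

module _ {a} {A : Set a} where

  ∑ : (A → ℕ) → List A → ℕ
  ∑ f []       = 0
  ∑ f (x ∷ xs) = f x + ∑ f xs

  ∑-cong-∈ : ∀ {f g : A → ℕ} xs → (∀ {x} → x ∈ xs → f x ≡ g x) → ∑ f xs ≡ ∑ g xs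
  ∑-cong-∈ []       eq = refl
  ∑-cong-∈ (x ∷ xs) eq = cong₂ _+_ (eq (here refl)) (∑-cong-∈ xs (eq ∘ there))

  ∑-cong : ∀ {f g : A → ℕ} xs → (∀ x → f x ≡ g x) → ∑ f xs ≡ ∑ g xs
  ∑-cong xs eq = ∑-cong-∈ xs (λ {x} _ → eq x)

  ∑-mono-≤-∈ : ∀ {f g : A → ℕ} xs → (∀ {x} → x ∈ xs → f x ≤ g x) → ∑ f xs ≤ ∑ g xs
  ∑-mono-≤-∈ []       le = z≤n
  ∑-mono-≤-∈ (x ∷ xs) le = +-mono-≤ (le (here refl)) (∑-mono-≤-∈ xs (le ∘ there))

  ∑-mono-≤ : ∀ {f g : A → ℕ} xs → (∀ x → f x ≤ g x) → ∑ f xs ≤ ∑ g xs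
  ∑-mono-≤ xs le = ∑-mono-≤-∈ xs (λ {x} _ → le x)

  ∑-+ : ∀ (f g : A → ℕ) xs → ∑ (λ x → f x + g x) xs ≡ ∑ f xs + ∑ g xs
  ∑-+ f g []       = refl
  ∑-+ f g (x ∷ xs) = trans (cong (f x + g x +_) (∑-+ f g xs)) (+-interchange (f x) (g x) (∑ f xs) (∑ g xs))

  ∑-*ˡ : ∀ c (f : A → ℕ) xs → ∑ (λ x → c * f x) xs ≡ c * ∑ f xs
  ∑-*ˡ c f []       = sym (*-zeroʳ c)
  ∑-*ˡ c f (x ∷ xs) = trans (cong (c * f x +_) (∑-*ˡ c f xs)) (sym (*-distribˡ-+ c (f x) (∑ f xs)))

  ∑-*ʳ : ∀ c (f : A → ℕ) xs → ∑ (λ x → f x * c) xs ≡ ∑ f xs * c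
  ∑-*ʳ c f []       = refl
  ∑-*ʳ c f (x ∷ xs) = trans (cong (f x * c +_) (∑-*ʳ c f xs)) (sym (*-distribʳ-+ c (f x) (∑ f xs)))

  ∑-const : ∀ c xs → ∑ (λ (_ : A) → c) xs ≡ length xs * c
  ∑-const c []       = refl
  ∑-const c (x ∷ xs) = cong (c +_) (∑-const c xs)

  ∑-++ : ∀ (f : A → ℕ) xs ys → ∑ f (xs ++ ys) ≡ ∑ f xs + ∑ f ys
  ∑-++ f []       ys = refl
  ∑-++ f (x ∷ xs) ys = trans (cong (f x +_) (∑-++ f xs ys)) (sym (+-assoc (f x) (∑ f xs) (∑ f ys)))

  ∑-≥1 : ∀ {p} {P : A → Set p} (f : A → ℕ) {xs} → Any P xs → (∀ {x} → P x → 1 ≤ f x) → 1 ≤ ∑ f xs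
  ∑-≥1 f {x ∷ xs} (here px) ≥1 = ≤-trans (≥1 px) (m≤m+n (f x) _)
  ∑-≥1 f {x ∷ xs} (there a) ≥1 = ≤-trans (∑-≥1 f a ≥1) (m≤n+m _ (f x))

  ∑-all-but-one : ∀ {S} → Unique S → ∀ {u} → u ∈ S → (f : A → ℕ) {q : ℕ} →
                  (∀ {v} → v ∈ S → v ≢ u → f v ≡ q) → ∑ f S + q ≡ f u + length S * q
  ∑-all-but-one {s ∷ S} (s∉S ∷ _) (here refl) f {q} others = begin
    (f s + ∑ f S) + q       ≡⟨ cong (λ t → f s + t + q) (trans (∑-cong-∈ S (λ v∈S → others (there v∈S) (s≢v v∈S))) (∑-const q S)) ⟩
    (f s + length S * q) + q ≡⟨ [x+y]+z≡x+[z+y] (f s) _ q ⟩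
    f s + length (s ∷ S) * q ∎
    where
    open ≡-Reasoning
    s≢v : ∀ {v} → v ∈ S → v ≢ s
    s≢v v∈S = ≢-sym (lookup s∉S v∈S)
  ∑-all-but-one {s ∷ S} (s∉S ∷ uniq) {u} (there u∈S) f {q} others = begin
    (f s + ∑ f S) + q        ≡⟨ cong (λ t → t + ∑ f S + q) (others (here refl) (lookup s∉S u∈S)) ⟩
    (q + ∑ f S) + q          ≡⟨ +-assoc q (∑ f S) q ⟩
    q + (∑ f S + q)          ≡⟨ cong (q +_) (∑-all-but-one uniq u∈S f (others ∘ there)) ⟩
    q + (f u + length S * q) ≡⟨ x+[y+z]≡y+[x+z] q (f u) (length S * q) ⟩
    f u + length (s ∷ S) * q ∎
    where open ≡-Reasoning

module _ {a b} {A : Set a} {B : Set b} where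

  ∑-swap : ∀ (f : A → B → ℕ) xs ys → ∑ (λ x → ∑ (f x) ys) xs ≡ ∑ (λ y → ∑ (λ x → f x y) xs) ys
  ∑-swap f []       ys = sym (trans (∑-const 0 ys) (*-zeroʳ (length ys)))
  ∑-swap f (x ∷ xs) ys = trans (cong (∑ (f x) ys +_) (∑-swap f xs ys)) (sym (∑-+ (f x) _ ys))

  ∑-map : ∀ (f : B → ℕ) (g : A → B) xs → ∑ f (map g xs) ≡ ∑ (f ∘ g) xs
  ∑-map f g []       = refl
  ∑-map f g (x ∷ xs) = cong (f (g x) +_) (∑-map f g xs)

  ∑-concatMap : ∀ (f : B → ℕ) (g : A → List B) xs → ∑ f (concatMap g xs) ≡ ∑ (∑ f ∘ g) xs
  ∑-concatMap f g []       = refl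
  ∑-concatMap f g (x ∷ xs) = trans (∑-++ f (g x) (concatMap g xs)) (cong (∑ f (g x) +_) (∑-concatMap f g xs))

𝟙 : ∀ {p} {P : Set p} → Dec P → ℕ
𝟙 (yes _) = 1
𝟙 (no _)  = 0

module _ {p} {P : Set p} where

  𝟙-yes : (P? : Dec P) → P → 𝟙 P? ≡ 1
  𝟙-yes (yes _) _  = refl
  𝟙-yes (no ¬p) p = contradiction p ¬p

  𝟙-no : (P? : Dec P) → ¬ P → 𝟙 P? ≡ 0
  𝟙-no (yes p) ¬p = contradiction p ¬p
  𝟙-no (no _)  _  = refl

  𝟙-¬ : (P? : Dec P) → 𝟙 P? + 𝟙 (¬? P?) ≡ 1
  𝟙-¬ (yes _) = refl
  𝟙-¬ (no _)  = refl

𝟙-mono : ∀ {p q} {P : Set p} {Q : Set q} (P? : Dec P) (Q? : Dec Q) → (P → Q) → 𝟙 P? ≤ 𝟙 Q?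
𝟙-mono (yes p) (no ¬q) P⇒Q = contradiction (P⇒Q p) ¬q
𝟙-mono (yes _) (yes _) _   = s≤s z≤n
𝟙-mono (no _)  _       _   = z≤n

module _ {p q} {P : Set p} {Q : Set q} where

  𝟙-cong : (P? : Dec P) (Q? : Dec Q) → (P → Q) → (Q → P) → 𝟙 P? ≡ 𝟙 Q?
  𝟙-cong P? Q? P⇒Q Q⇒P = ≤-antisym (𝟙-mono P? Q? P⇒Q) (𝟙-mono Q? P? Q⇒P)

  𝟙-× : (P? : Dec P) (Q? : Dec Q) → 𝟙 (P? ×-dec Q?) ≡ 𝟙 P? * 𝟙 Q?
  𝟙-× (yes _) (yes _) = refl
  𝟙-× (yes _) (no _)  = refl
  𝟙-× (no _)  _       = refl

module _ {A : Set} where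

  count≡∑𝟙 : ∀ {P : A → Set} (P? : ∀ x → Dec (P x)) xs → count P? xs ≡ ∑ (𝟙 ∘ P?) xs
  count≡∑𝟙 P? []       = refl
  count≡∑𝟙 P? (x ∷ xs) with P? x
  ... | yes _ = cong suc (count≡∑𝟙 P? xs)
  ... | no _  = count≡∑𝟙 P? xs

  length≡∑1 : (xs : List A) → length xs ≡ ∑ (λ _ → 1) xs
  length≡∑1 xs = sym (trans (∑-const 1 xs) (*-identityʳ (length xs)))

  count-complement : ∀ {P : A → Set} (P? : ∀ x → Dec (P x)) xs → count P? xs + count (¬? ∘ P?) xs ≡ length xs
  count-complement P? xs = begin
    count P? xs + count (¬? ∘ P?) xs     ≡⟨ cong₂ _+_ (count≡∑𝟙 P? xs) (count≡∑𝟙 (¬? ∘ P?) xs) ⟩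
    ∑ (𝟙 ∘ P?) xs + ∑ (𝟙 ∘ ¬? ∘ P?) xs   ≡⟨ ∑-+ (𝟙 ∘ P?) (𝟙 ∘ ¬? ∘ P?) xs ⟨
    ∑ (λ x → 𝟙 (P? x) + 𝟙 (¬? (P? x))) xs ≡⟨ ∑-cong xs (𝟙-¬ ∘ P?) ⟩
    ∑ (λ _ → 1) xs                      ≡⟨ length≡∑1 xs ⟨
    length xs                           ∎
    where open ≡-Reasoning

  count-mono : ∀ {P Q : A → Set} (P? : ∀ x → Dec (P x)) (Q? : ∀ x → Dec (Q x)) xs →
               (∀ {x} → P x → Q x) → count P? xs ≤ count Q? xs
  count-mono P? Q? xs P⇒Q = begin
    count P? xs   ≡⟨ count≡∑𝟙 P? xs ⟩
    ∑ (𝟙 ∘ P?) xs ≤⟨ ∑-mono-≤ xs (λ x → 𝟙-mono (P? x) (Q? x) P⇒Q) ⟩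
    ∑ (𝟙 ∘ Q?) xs ≡⟨ count≡∑𝟙 Q? xs ⟨
    count Q? xs   ∎
    where open ≤-Reasoning

  count-none : ∀ {P : A → Set} (P? : ∀ x → Dec (P x)) xs → (∀ {x} → ¬ P x) → count P? xs ≡ 0
  count-none P? []       none = refl
  count-none P? (x ∷ xs) none with P? x
  ... | yes p = contradiction p none
  ... | no _  = count-none P? xs none

  count-cong : ∀ {P Q : A → Set} (P? : ∀ x → Dec (P x)) (Q? : ∀ x → Dec (Q x)) xs →
               (∀ {x} → P x → Q x) → (∀ {x} → Q x → P x) → count P? xs ≡ count Q? xs
  count-cong P? Q? xs P⇒Q Q⇒P = ≤-antisym (count-mono P? Q? xs P⇒Q) (count-mono Q? P? xs Q⇒P)

  union-bound : ∀ {ι : Set} {P : A → Set} {E : ι → A → Set} (P? : ∀ x → Dec (P x)) (E? : ∀ i x → Dec (E i x)) (I : List ι) xs →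
                (∀ {x} → P x → Any (λ i → E i x) I) → count P? xs ≤ ∑ (λ i → count (E? i) xs) I
  union-bound P? E? I xs cover = begin
    count P? xs                          ≡⟨ count≡∑𝟙 P? xs ⟩
    ∑ (𝟙 ∘ P?) xs                        ≤⟨ ∑-mono-≤ xs covered ⟩
    ∑ (λ x → ∑ (λ i → 𝟙 (E? i x)) I) xs  ≡⟨ ∑-swap (λ x i → 𝟙 (E? i x)) xs I ⟩
    ∑ (λ i → ∑ (𝟙 ∘ E? i) xs) I          ≡⟨ ∑-cong I (λ i → count≡∑𝟙 (E? i) xs) ⟨
    ∑ (λ i → count (E? i) xs) I          ∎
    where
    open ≤-Reasoning
    covered : ∀ x → 𝟙 (P? x) ≤ ∑ (λ i → 𝟙 (E? i x)) I
    covered x with P? x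
    ... | no _  = z≤n
    ... | yes p = ∑-≥1 (λ i → 𝟙 (E? i x)) (cover p) (λ e → ≤-reflexive (sym (𝟙-yes (E? _ x) e)))

module _ {A : Set} (F : List A) where

  ∑-tuples-suc : ∀ m (f : List A → ℕ) → ∑ f (tuples F (suc m)) ≡ ∑ (λ h → ∑ (λ t → f (h ∷ t)) (tuples F m)) F
  ∑-tuples-suc m f = trans (∑-concatMap f (λ h → map (h ∷_) (tuples F m)) F)
                           (∑-cong F (λ h → ∑-map f (h ∷_) (tuples F m)))

  length-tuples : ∀ m → length (tuples F m) ≡ length F ^ m
  length-tuples zero    = refl
  length-tuples (suc m) = begin
    length (tuples F (suc m))                   ≡⟨ length≡∑1 (tuples F (suc m)) ⟩
    ∑ (λ _ → 1) (tuples F (suc m))              ≡⟨ ∑-tuples-suc m (λ _ → 1) ⟩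
    ∑ (λ _ → ∑ (λ _ → 1) (tuples F m)) F        ≡⟨ ∑-cong F (λ _ → trans (sym (length≡∑1 (tuples F m))) (length-tuples m)) ⟩
    ∑ (λ _ → length F ^ m) F                    ≡⟨ ∑-const (length F ^ m) F ⟩
    length F * length F ^ m                     ∎
    where open ≡-Reasoning

  count-all-tuples : ∀ {Q : A → Set} (Q? : ∀ x → Dec (Q x)) m → count (all? Q?) (tuples F m) ≡ count Q? F ^ m
  count-all-tuples Q? zero    = refl
  count-all-tuples Q? (suc m) = begin
    count (all? Q?) (tuples F (suc m))                            ≡⟨ count≡∑𝟙 (all? Q?) (tuples F (suc m)) ⟩
    ∑ (𝟙 ∘ all? Q?) (tuples F (suc m))                            ≡⟨ ∑-tuples-suc m (𝟙 ∘ all? Q?) ⟩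
    ∑ (λ h → ∑ (λ t → 𝟙 (all? Q? (h ∷ t))) (tuples F m)) F         ≡⟨ ∑-cong F (λ h → ∑-cong (tuples F m) (λ t → 𝟙-all-∷ h t)) ⟩
    ∑ (λ h → ∑ (λ t → 𝟙 (Q? h) * 𝟙 (all? Q? t)) (tuples F m)) F    ≡⟨ ∑-cong F (λ h → ∑-*ˡ (𝟙 (Q? h)) (𝟙 ∘ all? Q?) (tuples F m)) ⟩
    ∑ (λ h → 𝟙 (Q? h) * ∑ (𝟙 ∘ all? Q?) (tuples F m)) F           ≡⟨ ∑-*ʳ _ (𝟙 ∘ Q?) F ⟩
    ∑ (𝟙 ∘ Q?) F * ∑ (𝟙 ∘ all? Q?) (tuples F m)                   ≡⟨ cong₂ _*_ (count≡∑𝟙 Q? F) (count≡∑𝟙 (all? Q?) (tuples F m)) ⟨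
    count Q? F * count (all? Q?) (tuples F m)                     ≡⟨ cong (count Q? F *_) (count-all-tuples Q? m) ⟩
    count Q? F * count Q? F ^ m                                   ∎
    where
    open ≡-Reasoning
    𝟙-all-∷ : ∀ h t → 𝟙 (all? Q? (h ∷ t)) ≡ 𝟙 (Q? h) * 𝟙 (all? Q? t)
    𝟙-all-∷ h t = trans (𝟙-cong (all? Q? (h ∷ t)) (Q? h ×-dec all? Q? t) (λ { (q ∷ qs) → q , qs }) (λ (q , qs) → q ∷ qs))
                        (𝟙-× (Q? h) (all? Q? t))

∃≢ : ∀ {a} {A : Set a} → DecidableEquality A → ∀ {S : List A} → Unique S → 2 ≤ length S → ∀ u → ∃ λ (u′ : A) → u ≢ u′
∃≢ _≟_ {s ∷ s′ ∷ _} ((s≢s′ ∷ _) ∷ _) _ u with u ≟ s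
... | yes u≡s = s′ , λ u≡s′ → s≢s′ (trans (sym u≡s) u≡s′)
... | no u≢s  = s , u≢s
∃≢ _ {_ ∷ []} _ (s≤s ()) _

∑-𝟙≟ : ∀ {r} (w : Fin r) → ∑ (λ v → 𝟙 (w ≟ v)) (allFin r) ≡ 1
∑-𝟙≟ {r} w = trans (sym (+-identityʳ _))
  (trans (∑-all-but-one (Unique.allFin⁺ r) (∈-allFin w) (λ v → 𝟙 (w ≟ v)) (λ _ v≢w → 𝟙-no (w ≟ _) (v≢w ∘ sym)))
         (cong₂ _+_ (𝟙-yes (w ≟ w) refl) (*-zeroʳ (length (allFin r)))))

count-by-value : ∀ {A : Set} {r} {P : A → Set} (P? : ∀ x → Dec (P x)) (φ : A → Fin r) xs →
                 count P? xs ≡ ∑ (λ v → count (λ x → P? x ×-dec (φ x ≟ v)) xs) (allFin r)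
count-by-value {r = r} P? φ xs = begin
  count P? xs                                                     ≡⟨ count≡∑𝟙 P? xs ⟩
  ∑ (𝟙 ∘ P?) xs                                                   ≡⟨ ∑-cong xs (λ x → *-identityʳ _) ⟨
  ∑ (λ x → 𝟙 (P? x) * 1) xs                                       ≡⟨ ∑-cong xs (λ x → cong (𝟙 (P? x) *_) (∑-𝟙≟ (φ x))) ⟨
  ∑ (λ x → 𝟙 (P? x) * ∑ (λ v → 𝟙 (φ x ≟ v)) (allFin r)) xs        ≡⟨ ∑-cong xs (λ x → ∑-*ˡ (𝟙 (P? x)) (λ v → 𝟙 (φ x ≟ v)) (allFin r)) ⟨
  ∑ (λ x → ∑ (λ v → 𝟙 (P? x) * 𝟙 (φ x ≟ v)) (allFin r)) xs        ≡⟨ ∑-cong xs (λ x → ∑-cong (allFin r) (λ v → 𝟙-× (P? x) (φ x ≟ v))) ⟨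
  ∑ (λ x → ∑ (λ v → 𝟙 (P? x ×-dec (φ x ≟ v))) (allFin r)) xs      ≡⟨ ∑-swap (λ x v → 𝟙 (P? x ×-dec (φ x ≟ v))) xs (allFin r) ⟩
  ∑ (λ v → ∑ (λ x → 𝟙 (P? x ×-dec (φ x ≟ v))) xs) (allFin r)      ≡⟨ ∑-cong (allFin r) (λ v → count≡∑𝟙 (λ x → P? x ×-dec (φ x ≟ v)) xs) ⟨
  ∑ (λ v → count (λ x → P? x ×-dec (φ x ≟ v)) xs) (allFin r)      ∎
  where open ≡-Reasoning

-- (n − 1)(n − 2) ≥ 0
3*n≤2+n*n : ∀ n → 3 * n ≤ 2 + n * n
3*n≤2+n*n 0             = z≤n
3*n≤2+n*n 1             = ≤-refl
3*n≤2+n*n 2             = ≤-refl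
3*n≤2+n*n n@(suc (suc (suc _))) = begin
  3 * n     ≡⟨ *-comm 3 n ⟩
  n * 3     ≤⟨ *-monoʳ-≤ n (s≤s (s≤s (s≤s z≤n))) ⟩
  n * n     ≤⟨ m≤n+m (n * n) 2 ⟩
  2 + n * n ∎
  where open ≤-Reasoning

Nonvanishing : ∀ {g r} → List (Pair g) → (Pair g → Fin (suc r)) → Set
Nonvanishing S h = All (λ u → h u ≢ 0F) S

nonvanishing? : ∀ {g r} (S : List (Pair g)) (h : Pair g → Fin (suc r)) → Dec (Nonvanishing S h)
nonvanishing? S h = all? (λ u → ¬? (h u ≟ 0F)) S

module PairwiseIndependence {g k : ℕ} (F : List (Pair g → Fin (suc (suc k)))) (indep : PairwiseIndependent F) where

  private
    r = suc (suc k)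
    N = length F

  uniform-marginal : ∀ {u u′} → u ≢ u′ → ∀ v → count (λ h → h u ≟ v) F * r ≡ N
  uniform-marginal {u} {u′} u≢u′ v = *-cancelʳ-≡ _ _ r (begin
    count (λ h → h u ≟ v) F * r * r                   ≡⟨ *-assoc (count (λ h → h u ≟ v) F) r r ⟩
    count (λ h → h u ≟ v) F * (r * r)                 ≡⟨ cong (_* (r * r)) (count-by-value (λ h → h u ≟ v) (λ h → h u′) F) ⟩
    ∑ (λ v′ → count (joint v′) F) (allFin r) * (r * r) ≡⟨ ∑-*ʳ (r * r) (λ v′ → count (joint v′) F) (allFin r) ⟨
    ∑ (λ v′ → count (joint v′) F * (r * r)) (allFin r) ≡⟨ ∑-cong (allFin r) (indep u u′ u≢u′ v) ⟩
    ∑ (λ _ → N) (allFin r)                            ≡⟨ ∑-const N (allFin r) ⟩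
    length (allFin r) * N                             ≡⟨ cong (_* N) (length-tabulate {n = r} (λ x → x)) ⟩
    r * N                                             ≡⟨ *-comm r N ⟩
    N * r                                             ∎)
    where
    open ≡-Reasoning
    joint : ∀ v′ h → Dec (h u ≡ v × h u′ ≡ v′)
    joint v′ h = (h u ≟ v) ×-dec (h u′ ≟ v′)

  zeros : List (Pair g) → (Pair g → Fin r) → ℕ
  zeros S h = ∑ (λ u → 𝟙 (h u ≟ 0F)) S

  private
    vanishing : Pair g → ℕ
    vanishing u = count (λ h → h u ≟ 0F) F

    vanishing² : Pair g → Pair g → ℕ
    vanishing² u u′ = count (λ h → (h u ≟ 0F) ×-dec (h u′ ≟ 0F)) F

    vanishing²-diag : ∀ u → vanishing² u u ≡ vanishing u
    vanishing²-diag u = count-cong _ _ F (λ (p , _) → p) (λ p → p , p)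

    ∑-zeros²≡∑∑vanishing² : ∀ S → ∑ (λ h → zeros S h * zeros S h) F ≡ ∑ (λ u → ∑ (vanishing² u) S) S
    ∑-zeros²≡∑∑vanishing² S = begin
      ∑ (λ h → zeros S h * zeros S h) F                                          ≡⟨ ∑-cong F square ⟩
      ∑ (λ h → ∑ (λ u → ∑ (λ u′ → 𝟙 ((h u ≟ 0F) ×-dec (h u′ ≟ 0F))) S) S) F ≡⟨ ∑-swap _ F S ⟩
      ∑ (λ u → ∑ (λ h → ∑ (λ u′ → 𝟙 ((h u ≟ 0F) ×-dec (h u′ ≟ 0F))) S) F) S ≡⟨ ∑-cong S (λ u → ∑-swap _ F S) ⟩
      ∑ (λ u → ∑ (λ u′ → ∑ (λ h → 𝟙 ((h u ≟ 0F) ×-dec (h u′ ≟ 0F))) F) S) S ≡⟨ ∑-cong S (λ u → ∑-cong S (λ u′ → count≡∑𝟙 _ F)) ⟨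
      ∑ (λ u → ∑ (vanishing² u) S) S                                             ∎
      where
      open ≡-Reasoning
      𝟙₀ : (Pair g → Fin r) → Pair g → ℕ
      𝟙₀ h u = 𝟙 (h u ≟ 0F)
      square : ∀ h → zeros S h * zeros S h ≡ ∑ (λ u → ∑ (λ u′ → 𝟙 ((h u ≟ 0F) ×-dec (h u′ ≟ 0F))) S) S
      square h = begin
        zeros S h * zeros S h                                      ≡⟨ ∑-*ʳ (zeros S h) (𝟙₀ h) S ⟨
        ∑ (λ u → 𝟙₀ h u * zeros S h) S                             ≡⟨ ∑-cong S (λ u → ∑-*ˡ (𝟙₀ h u) (𝟙₀ h) S) ⟨
        ∑ (λ u → ∑ (λ u′ → 𝟙₀ h u * 𝟙₀ h u′) S) S                 ≡⟨ ∑-cong S (λ u → ∑-cong S (λ u′ → 𝟙-× (h u ≟ 0F) (h u′ ≟ 0F))) ⟨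
        ∑ (λ u → ∑ (λ u′ → 𝟙 ((h u ≟ 0F) ×-dec (h u′ ≟ 0F))) S) S ∎

  module _ {S : List (Pair g)} (S! : Unique S) (|S|≡r : length S ≡ r) where

    private
      partner : ∀ u → ∃ λ u′ → u ≢ u′
      partner = ∃≢ _≟P_ S! (subst (2 ≤_) (sym |S|≡r) (s≤s (s≤s z≤n)))

      vanishing*r≡N : ∀ u → vanishing u * r ≡ N
      vanishing*r≡N u = uniform-marginal (proj₂ (partner u)) 0F

    ∑-zeros : ∑ (zeros S) F ≡ N
    ∑-zeros = *-cancelʳ-≡ _ _ r (begin
      ∑ (zeros S) F * r                         ≡⟨ cong (_* r) (∑-swap (λ h u → 𝟙 (h u ≟ 0F)) F S) ⟩
      ∑ (λ u → ∑ (λ h → 𝟙 (h u ≟ 0F)) F) S * r  ≡⟨ cong (_* r) (∑-cong S (λ u → count≡∑𝟙 _ F)) ⟨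
      ∑ vanishing S * r                         ≡⟨ ∑-*ʳ r vanishing S ⟨
      ∑ (λ u → vanishing u * r) S               ≡⟨ ∑-cong S vanishing*r≡N ⟩
      ∑ (λ _ → N) S                             ≡⟨ ∑-const N S ⟩
      length S * N                              ≡⟨ cong (_* N) |S|≡r ⟩
      r * N                                     ≡⟨ *-comm r N ⟩
      N * r                                     ∎)
      where open ≡-Reasoning

    private
      row-bound : ∀ {u} → u ∈ S → ∑ (λ u′ → vanishing² u u′ * (r * r)) S ≤ r * N + r * N
      row-bound {u} u∈S = m+n≤o⇒m≤o _ (≤-reflexive (begin
        ∑ (λ u′ → vanishing² u u′ * (r * r)) S + N    ≡⟨ ∑-all-but-one S! u∈S (λ u′ → vanishing² u u′ * (r * r)) off-diagonal ⟩
        vanishing² u u * (r * r) + length S * N       ≡⟨ cong₂ (λ a b → a * (r * r) + b * N) (vanishing²-diag u) |S|≡r ⟩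
        vanishing u * (r * r) + r * N                 ≡⟨ cong (_+ r * N) (sym (*-assoc (vanishing u) r r)) ⟩
        vanishing u * r * r + r * N                   ≡⟨ cong (λ a → a * r + r * N) (vanishing*r≡N u) ⟩
        N * r + r * N                                 ≡⟨ cong (_+ r * N) (*-comm N r) ⟩
        r * N + r * N                                 ∎))
        where
        open ≡-Reasoning
        off-diagonal : ∀ {u′} → u′ ∈ S → u′ ≢ u → vanishing² u u′ * (r * r) ≡ N
        off-diagonal _ u′≢u = indep u _ (u′≢u ∘ sym) 0F 0F

    ∑-zeros² : ∑ (λ h → zeros S h * zeros S h) F ≤ 2 * N
    ∑-zeros² = *-cancelʳ-≤ _ _ (r * r) (begin
      ∑ (λ h → zeros S h * zeros S h) F * (r * r)          ≡⟨ cong (_* (r * r)) (∑-zeros²≡∑∑vanishing² S) ⟩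
      ∑ (λ u → ∑ (vanishing² u) S) S * (r * r)             ≡⟨ ∑-*ʳ (r * r) _ S ⟨
      ∑ (λ u → ∑ (vanishing² u) S * (r * r)) S             ≡⟨ ∑-cong S (λ u → ∑-*ʳ (r * r) (vanishing² u) S) ⟨
      ∑ (λ u → ∑ (λ u′ → vanishing² u u′ * (r * r)) S) S   ≤⟨ ∑-mono-≤-∈ S row-bound ⟩
      ∑ (λ _ → r * N + r * N) S                            ≡⟨ ∑-const _ S ⟩
      length S * (r * N + r * N)                           ≡⟨ cong (_* (r * N + r * N)) |S|≡r ⟩
      r * (r * N + r * N)                                  ≡⟨ solve 2 (λ r N → r :* (r :* N :+ r :* N) := con 2 :* N :* (r :* r)) refl r N ⟩
      2 * N * (r * r)                                      ∎)
      where open ≤-Reasoning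

    private
      nonvanishing⇒zeros≡0 : ∀ {h} → Nonvanishing S h → zeros S h ≡ 0
      nonvanishing⇒zeros≡0 {h} nv = trans (∑-cong-∈ S (λ u∈S → 𝟙-no (h _ ≟ 0F) (lookup nv u∈S)))
                                          (trans (∑-const 0 S) (*-zeroʳ (length S)))

      zeros-pointwise : ∀ h → 3 * zeros S h + 2 * 𝟙 (nonvanishing? S h) ≤ 2 + zeros S h * zeros S h
      zeros-pointwise h with nonvanishing? S h
      ... | yes nv rewrite nonvanishing⇒zeros≡0 nv = ≤-refl
      ... | no _   rewrite +-identityʳ (3 * zeros S h) = 3*n≤2+n*n (zeros S h)

    2*count-nonvanishing≤N : 2 * count (nonvanishing? S) F ≤ N
    2*count-nonvanishing≤N = +-cancelˡ-≤ (3 * N) _ _ (begin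
      3 * N + 2 * count (nonvanishing? S) F                           ≡⟨ cong₂ (λ a b → 3 * a + 2 * b) (sym ∑-zeros) (count≡∑𝟙 (nonvanishing? S) F) ⟩
      3 * ∑ (zeros S) F + 2 * ∑ (𝟙 ∘ nonvanishing? S) F              ≡⟨ cong₂ _+_ (∑-*ˡ 3 (zeros S) F) (∑-*ˡ 2 (𝟙 ∘ nonvanishing? S) F) ⟨
      ∑ (λ h → 3 * zeros S h) F + ∑ (λ h → 2 * 𝟙 (nonvanishing? S h)) F ≡⟨ ∑-+ _ _ F ⟨
      ∑ (λ h → 3 * zeros S h + 2 * 𝟙 (nonvanishing? S h)) F          ≤⟨ ∑-mono-≤ F zeros-pointwise ⟩
      ∑ (λ h → 2 + zeros S h * zeros S h) F                           ≡⟨ ∑-+ _ _ F ⟩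
      ∑ (λ _ → 2) F + ∑ (λ h → zeros S h * zeros S h) F               ≤⟨ +-monoʳ-≤ (∑ (λ _ → 2) F) ∑-zeros² ⟩
      ∑ (λ _ → 2) F + 2 * N                                           ≡⟨ cong (_+ 2 * N) (∑-const 2 F) ⟩
      N * 2 + 2 * N                                                   ≡⟨ solve 1 (λ N → N :* con 2 :+ con 2 :* N := con 3 :* N :+ N) refl N ⟩
      3 * N + N                                                       ∎)
      where open ≤-Reasoning

window : ∀ {A : Set} → List A → ℕ → ℕ → List A
window xs a b = take b (drop a xs)

distinct : ∀ {g} → List (Pair g) → ℕ
distinct = length ∘ deduplicate _≟P_

Uncut : ∀ {g r} → List (Pair g → Fin r) → List (Pair g) → Set
Uncut hs = All (λ u → ¬ HZero hs u)

RichUncut : ∀ {g r} → ℕ → List (Pair g) → List (Pair g → Fin r) → Set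
RichUncut K W hs = K ≤ distinct W × Uncut hs W

richUncut? : ∀ {g r} K W (hs : List (Pair g → Fin r)) → Dec (RichUncut K W hs)
richUncut? K W hs = (K ≤? distinct W) ×-dec all? (λ u → ¬? (HZero? hs u)) W

module _ {A : Set} where

  pairs-drop : ∀ n (xs : List A) → pairs (drop n xs) ≡ drop n (pairs xs)
  pairs-drop zero          xs           = refl
  pairs-drop (suc n)       []           = refl
  pairs-drop (suc zero)    (x ∷ [])     = refl
  pairs-drop (suc (suc n)) (x ∷ [])     = refl
  pairs-drop (suc n)       (x ∷ y ∷ xs) = pairs-drop n (y ∷ xs)

  pairs-take : ∀ n (xs : List A) → pairs (take (suc n) xs) ≡ take n (pairs xs)
  pairs-take zero    []           = refl
  pairs-take zero    (x ∷ xs)     = refl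
  pairs-take (suc n) []           = refl
  pairs-take (suc n) (x ∷ [])     = refl
  pairs-take (suc n) (x ∷ y ∷ xs) = cong ((x , y) ∷_) (pairs-take n (y ∷ xs))

  length-pairs : ∀ (xs : List A) → length (pairs xs) ≡ length xs ∸ 1
  length-pairs []           = refl
  length-pairs (x ∷ [])     = refl
  length-pairs (x ∷ y ∷ xs) = cong suc (length-pairs (y ∷ xs))

  drop-++-∷ : ∀ (xs : List A) y ys → drop (suc (length xs)) (xs ++ y ∷ ys) ≡ ys
  drop-++-∷ []       y ys = refl
  drop-++-∷ (x ∷ xs) y ys = drop-++-∷ xs y ys

  take-++⁺ : ∀ {P : A → Set} {xs} n ys → n ≤ length xs → All P xs → All P (take n (xs ++ ys))
  take-++⁺ zero    ys _         _          = []
  take-++⁺ (suc n) ys (s≤s n≤l) (px ∷ pxs) = px ∷ take-++⁺ n ys n≤l pxs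

Dict-take : ∀ {g} n (w : List (Fin g)) → length (Dict (take n w)) ≤ suc (distinct (take (n ∸ 2) (drop 1 (pairs w))))
Dict-take zero          w            = z≤n
Dict-take (suc zero)    []           = z≤n
Dict-take (suc zero)    (x ∷ w)      = z≤n
Dict-take (suc (suc n)) []           = z≤n
Dict-take (suc (suc n)) (x ∷ [])     = z≤n
Dict-take (suc (suc n)) (x ∷ y ∷ w)  =
  subst (λ ps → length (Dict (x ∷ y ∷ take n w)) ≤ suc (distinct ps)) (pairs-take n (y ∷ w)) (s≤s (length-filter _ (deduplicate _≟P_ (pairs (y ∷ take n w)))))

-- The pairs of the block B[x+1, y) sit at positions x, …, y−3 of pairs B (counting from 0);
-- all but the first lie in the window below.
Dict-sub : ∀ {g} (B : List (Fin g)) x y → length (Dict (sub B (suc x) y)) ≤ suc (distinct (window (pairs B) (suc x) (y ∸ suc x ∸ 2)))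
Dict-sub B x y = subst (λ ps → length (Dict (sub B (suc x) y)) ≤ suc (distinct (take (y ∸ suc x ∸ 2) ps))) drop-pairs (Dict-take (y ∸ suc x) (drop x B))
  where
  drop-pairs : drop 1 (pairs (drop x B)) ≡ drop (suc x) (pairs B)
  drop-pairs = trans (cong (drop 1) (pairs-drop x B)) (trans (drop-drop x 1 (pairs B)) (cong (λ k → drop k (pairs B)) (+-comm x 1)))

module SplitScan {g r} (hs : List (Pair g → Fin r)) (B : List (Fin g)) (K : ℕ) where

  -- `cutPoints` runs its scanning loop in a `where` block; `scan` names that loop,
  -- its body being found by unification in `cutPoints≡scan`.
  mutual
    scan : ℕ → List (Pair g) → List ℕ
    scan = _

    cutPoints≡scan : cutPoints hs B ≡ scan 2 (drop 1 (pairs B))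
    cutPoints≡scan with 2 | drop 1 (pairs B)
    ... | _ | _ = refl

  private
    P = pairs B
    E = suc (length B)

  RichWindow : Set
  RichWindow = ∃₂ λ a b → RichUncut K (window P a b) hs

  Heavy : List (Fin g) → Set
  Heavy Bj = ¬ length (Dict Bj) ≤ K

  private
    heavy-block : ∀ x y → Heavy (sub B (suc x) y) → Uncut hs (window P (suc x) (y ∸ suc x ∸ 2)) → RichWindow
    heavy-block x y heavy uncut = suc x , _ , s≤s⁻¹ (≤-trans (≰⇒> heavy) (Dict-sub B x y)) , uncut

    -- Scanning R, the last cut is at suc x and T holds the uncut pairs read since.
    scan-heavy : ∀ R x T i → i ≡ suc x + suc (length T) → drop (suc x) P ≡ T ++ R → Uncut hs T →
                 Any Heavy (slices B (suc x ∷ scan i R ++ [ E ])) → RichWindow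
    scan-heavy [] x T _ refl drop≡ uncut (here heavy) =
      heavy-block x E heavy (take⁺ _ (subst (Uncut hs) (sym (trans drop≡ (++-identityʳ T))) uncut))
    scan-heavy (p ∷ R) x T _ refl drop≡ uncut heavy with HZero? hs p
    scan-heavy (p ∷ R) x T _ refl drop≡ uncut (here heavy) | yes _ =
      heavy-block x (suc x + suc (length T)) heavy (subst (Uncut hs) (cong (take _) (sym drop≡)) (take-++⁺ _ (p ∷ R) n≤|T| uncut))
      where
      n≤|T| : suc x + suc (length T) ∸ suc x ∸ 2 ≤ length T
      n≤|T| = subst (λ k → k ∸ 2 ≤ length T) (sym (m+n∸m≡n (suc x) (suc (length T)))) (m∸n≤m (length T) 1)
    scan-heavy (p ∷ R) x T _ refl drop≡ uncut (there heavy) | yes _ =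
      scan-heavy R (x + suc (length T)) [] _ (+-comm 1 _) drop≡′ [] heavy
      where
      drop≡′ : drop (suc x + suc (length T)) P ≡ R
      drop≡′ = trans (sym (drop-drop (suc x) (suc (length T)) P)) (trans (cong (drop (suc (length T))) drop≡) (drop-++-∷ T p R))
    scan-heavy (p ∷ R) x T _ refl drop≡ uncut heavy | no cut =
      scan-heavy R x (T ++ [ p ]) _ i≡ (trans drop≡ (sym (++-assoc T [ p ] R))) (++⁺ uncut (cut ∷ [])) heavy
      where
      i≡ : suc (suc x + suc (length T)) ≡ suc x + suc (length (T ++ [ p ]))
      i≡ = trans (sym (+-suc (suc x) (suc (length T)))) (cong (λ k → suc x + suc k) (sym (trans (length-++ T) (+-comm (length T) 1))))

  Split-heavy⇒rich : ¬ All (λ Bj → length (Dict Bj) ≤ K) (Split hs B) → RichWindow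
  Split-heavy⇒rich light = scan-heavy (drop 1 P) 0 [] 2 refl refl []
    (subst (λ cs → Any Heavy (slices B (1 ∷ cs ++ [ E ]))) cutPoints≡scan (¬All⇒Any¬ (λ Bj → length (Dict Bj) ≤? K) (Split hs B) light))

module _ {A : Set} (xs : List A) where

  drop-bounded : ∀ a → ∃ λ a′ → a′ ≤ length xs × drop a′ xs ≡ drop a xs
  drop-bounded a with a ≤? length xs
  ... | yes a≤ = a , a≤ , refl
  ... | no a≰  = length xs , ≤-refl , trans (drop-all (length xs) xs ≤-refl) (sym (drop-all a xs (<⇒≤ (≰⇒> a≰))))

take-bounded : ∀ {A : Set} b (ys : List A) → ∃ λ b′ → b′ ≤ length ys × take b′ ys ≡ take b ys
take-bounded b ys with b ≤? length ys
... | yes b≤ = b , b≤ , refl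
... | no b≰  = length ys , ≤-refl , trans (take-all (length ys) ys ≤-refl) (sym (take-all b ys (<⇒≤ (≰⇒> b≰))))

window-bounded : ∀ {A : Set} (xs : List A) a b → ∃₂ λ a′ b′ → a′ ≤ length xs × b′ ≤ length xs × window xs a′ b′ ≡ window xs a b
window-bounded xs a b with drop-bounded xs a
... | a′ , a′≤ , drop≡ with take-bounded b (drop a′ xs)
...   | b′ , b′≤ , take≡ = a′ , b′ , a′≤ , ≤-trans b′≤ (≤-trans (≤-reflexive (length-drop a′ xs)) (m∸n≤m _ a′)) , trans take≡ (cong (take b) drop≡)

¬HZero⇒nonvanishing : ∀ {g r} (hs : List (Pair g → Fin (suc r))) {u} → ¬ HZero hs u → All (λ h → h u ≢ 0F) hs
¬HZero⇒nonvanishing []       _       = []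
¬HZero⇒nonvanishing (h ∷ hs) {u} ¬zero =
  (λ hu≡0 → ¬zero (cong (λ v → toℕ v * _) hu≡0)) ∷
  ¬HZero⇒nonvanishing hs (λ rest≡0 → ¬zero (trans (cong (toℕ (h u) *_) rest≡0) (*-zeroʳ (toℕ (h u)))))

All-swap : ∀ {A B : Set} {R : A → B → Set} {xs : List A} {ys : List B} →
           All (λ x → All (R x) ys) xs → All (λ y → All (λ x → R x y) xs) ys
All-swap rows = tabulate (λ y∈ → tabulate (λ x∈ → lookup (lookup rows x∈) y∈))

*-^-≤ : ∀ {a b c} m → a * b ≤ c → a ^ m * b ^ m ≤ c ^ m
*-^-≤ zero    _  = ≤-refl
*-^-≤ {a} {b} {c} (suc m) ab≤c = begin
  (a * a ^ m) * (b * b ^ m) ≡⟨ *-interchange a (a ^ m) b (b ^ m) ⟩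
  (a * b) * (a ^ m * b ^ m) ≤⟨ *-mono-≤ ab≤c (*-^-≤ m ab≤c) ⟩
  c * c ^ m                 ∎
  where open ≤-Reasoning

length-cartesianProduct : ∀ {A B : Set} (xs : List A) (ys : List B) → length (cartesianProduct xs ys) ≡ length xs * length ys
length-cartesianProduct []       ys = refl
length-cartesianProduct (x ∷ xs) ys = trans (length-++ (map (x ,_) ys)) (cong₂ _+_ (length-map (x ,_) ys) (length-cartesianProduct xs ys))

module HeavyTuples {g k : ℕ} (F : List (Pair g → Fin (suc (suc k)))) (indep : PairwiseIndependent F) where

  private
    r = suc (suc k)
    N = length F

  2^m*count-richUncut≤N^m : ∀ {K} → r ≤ K → ∀ m W → 2 ^ m * count (richUncut? K W) (tuples F m) ≤ N ^ m
  2^m*count-richUncut≤N^m {K} r≤K m W with r ≤? distinct W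
  ... | no r≰ = begin
    2 ^ m * count (richUncut? K W) (tuples F m) ≡⟨ cong (2 ^ m *_) (count-none _ (tuples F m) (λ (K≤ , _) → r≰ (≤-trans r≤K K≤))) ⟩
    2 ^ m * 0                                   ≡⟨ *-zeroʳ (2 ^ m) ⟩
    0                                           ≤⟨ z≤n ⟩
    N ^ m                                       ∎
    where open ≤-Reasoning
  ... | yes r≤ = begin
    2 ^ m * count (richUncut? K W) (tuples F m)               ≤⟨ *-monoʳ-≤ (2 ^ m) (count-mono _ _ (tuples F m) rich⇒nonvanishing) ⟩
    2 ^ m * count (all? (nonvanishing? S)) (tuples F m)       ≡⟨ cong (2 ^ m *_) (count-all-tuples F (nonvanishing? S) m) ⟩
    2 ^ m * count (nonvanishing? S) F ^ m                     ≤⟨ *-^-≤ m (PairwiseIndependence.2*count-nonvanishing≤N F indep S! |S|≡r) ⟩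
    N ^ m                                                     ∎
    where
    open ≤-Reasoning
    S = take r (deduplicate _≟P_ W)
    S! = Unique.take⁺ r (UniqueDec.deduplicate-! _≟P_ W)
    |S|≡r : length S ≡ r
    |S|≡r = trans (length-take r (deduplicate _≟P_ W)) (m≤n⇒m⊓n≡m r≤)
    rich⇒nonvanishing : ∀ {hs} → RichUncut K W hs → All (Nonvanishing S) hs
    rich⇒nonvanishing {hs} (_ , uncut) = All-swap (All.map (¬HZero⇒nonvanishing hs) (take⁺ r (deduplicate⁺ _≟P_ uncut)))

  heavy-tuples-bound : ∀ {K} → r ≤ K → ∀ {n m} (B : List (Fin g)) → length (pairs B) < n → n ^ 5 ≤ 2 ^ m →
    n ^ 3 * count (λ hs → ¬? (all? (λ Bj → length (Dict Bj) ≤? K) (Split hs B))) (tuples F m) ≤ N ^ m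
  heavy-tuples-bound {K} r≤K {n} {m} B |P|<n n^5≤2^m = *-cancelˡ-≤ (2 ^ m) {{m^n≢0 2 m}} (begin
    2 ^ m * (n ^ 3 * heavy)                                ≡⟨ x*[y*z]≡y*[x*z] (2 ^ m) (n ^ 3) heavy ⟩
    n ^ 3 * (2 ^ m * heavy)                                ≤⟨ *-monoʳ-≤ (n ^ 3) (*-monoʳ-≤ (2 ^ m) union) ⟩
    n ^ 3 * (2 ^ m * ∑ rich windows)                        ≡⟨ cong (n ^ 3 *_) (∑-*ˡ (2 ^ m) rich windows) ⟨
    n ^ 3 * ∑ (λ ab → 2 ^ m * rich ab) windows              ≤⟨ *-monoʳ-≤ (n ^ 3) (∑-mono-≤ windows (λ (a , b) → 2^m*count-richUncut≤N^m r≤K m (window P a b))) ⟩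
    n ^ 3 * ∑ (λ _ → N ^ m) windows                         ≡⟨ cong (n ^ 3 *_) (trans (∑-const (N ^ m) windows) (cong (_* N ^ m) |windows|)) ⟩
    n ^ 3 * (n * n * N ^ m)                                 ≡⟨ solve 2 (λ n q → n :^ 3 :* (n :* n :* q) := n :^ 5 :* q) refl n (N ^ m) ⟩
    n ^ 5 * N ^ m                                           ≤⟨ *-monoˡ-≤ (N ^ m) n^5≤2^m ⟩
    2 ^ m * N ^ m                                           ∎)
    where
    open ≤-Reasoning
    P = pairs B
    T = tuples F m
    light? = λ hs → all? (λ Bj → length (Dict Bj) ≤? K) (Split hs B)
    heavy = count (λ hs → ¬? (light? hs)) T
    windows = cartesianProduct (upTo n) (upTo n)
    rich : ℕ × ℕ → ℕ
    rich (a , b) = count (richUncut? K (window P a b)) T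
    |windows| : length windows ≡ n * n
    |windows| = trans (length-cartesianProduct (upTo n) (upTo n)) (cong₂ _*_ (length-upTo n) (length-upTo n))
    cover : ∀ {hs} → ¬ All (λ Bj → length (Dict Bj) ≤ K) (Split hs B) → Any (λ (a , b) → RichUncut K (window P a b) hs) windows
    cover {hs} heavy with SplitScan.Split-heavy⇒rich hs B K heavy
    ... | a , b , rich with window-bounded P a b
    ...   | a′ , b′ , a′≤ , b′≤ , window≡ = lose (∈-cartesianProduct⁺ (∈-upTo⁺ (≤-<-trans a′≤ |P|<n)) (∈-upTo⁺ (≤-<-trans b′≤ |P|<n)))
                                                (subst (λ W → RichUncut K W hs) (sym window≡) rich)
    union : heavy ≤ ∑ rich windows
    union = union-bound (λ hs → ¬? (light? hs)) (λ (a , b) → richUncut? K (window P a b)) windows T cover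

1≤codomain : ∀ {A : Set} {r} (F : List (A → Fin r)) → F ≢ [] → A → 1 ≤ r
1≤codomain []      F≢[] _ = contradiction refl F≢[]
1≤codomain (h ∷ _) _    a = ≤-trans (s≤s z≤n) (toℕ<n (h a))

heavy-tuples-bound : ∀ {g r} (F : List (Pair g → Fin r)) → F ≢ [] → PairwiseIndependent F → r ≢ 1 →
  ∀ {K} → r ≤ K → ∀ {n m} (B : List (Fin g)) → length B ≤ n → n ^ 5 ≤ 2 ^ m →
  n ^ 3 * count (λ hs → ¬? (all? (λ Bj → length (Dict Bj) ≤? K) (Split hs B))) (tuples F m) ≤ length F ^ m
heavy-tuples-bound F _ _ _ _ {n} {m} [] _ _ = begin
  n ^ 3 * count _ (tuples F m) ≡⟨ cong (n ^ 3 *_) (count-none _ (tuples F m) (λ heavy → heavy (z≤n ∷ []))) ⟩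
  n ^ 3 * 0                    ≡⟨ *-zeroʳ (n ^ 3) ⟩
  0                            ≤⟨ z≤n ⟩
  length F ^ m                 ∎
  where open ≤-Reasoning
heavy-tuples-bound F F≢[] indep r≢1 r≤K {n} {m} (x ∷ B) |B|≤n n^5≤2^m
  with ≤∧≢⇒< (1≤codomain F F≢[] (x , x)) (r≢1 ∘ sym)
... | s≤s (s≤s _) = HeavyTuples.heavy-tuples-bound F indep r≤K {m = m} (x ∷ B) (subst (_< n) (sym (length-pairs (x ∷ B))) |B|≤n) n^5≤2^m

n≤2^⌈log2⌉n : ∀ n (acc : Acc _<_ n) → n ≤ 2 ^ ⌈log2⌉ n acc
n≤2^⌈log2⌉n zero          _        = z≤n
n≤2^⌈log2⌉n (suc zero)    _        = s≤s z≤n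
n≤2^⌈log2⌉n (suc (suc n)) (acc rs) = begin
  2 + n                               ≤⟨ s≤s (s≤s n≤2⌈n/2⌉) ⟩
  2 + (⌈ n /2⌉ + ⌈ n /2⌉)             ≡⟨ solve 1 (λ c → con 2 :+ (c :+ c) := con 2 :* (con 1 :+ c)) refl ⌈ n /2⌉ ⟩
  2 * suc ⌈ n /2⌉                     ≤⟨ *-monoʳ-≤ 2 (n≤2^⌈log2⌉n (suc ⌈ n /2⌉) _) ⟩
  2 ^ ⌈log2⌉ (2 + n) (acc rs)         ∎
  where
  open ≤-Reasoning
  n≤2⌈n/2⌉ : n ≤ ⌈ n /2⌉ + ⌈ n /2⌉
  n≤2⌈n/2⌉ = ≤-trans (≤-reflexive (sym (⌊n/2⌋+⌈n/2⌉≡n n))) (+-monoˡ-≤ ⌈ n /2⌉ (⌊n/2⌋≤⌈n/2⌉ n))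

n^5≤2^[5*⌈log₂n⌉] : ∀ n → n ^ 5 ≤ 2 ^ (5 * ⌈log₂ n ⌉)
n^5≤2^[5*⌈log₂n⌉] n = ≤-trans (^-monoˡ-≤ 5 (n≤2^⌈log2⌉n n (<-wellFounded n)))
                               (≤-reflexive (trans (^-*-assoc 2 ⌈log₂ n ⌉ 5) (cong (2 ^_) (*-comm ⌈log₂ n ⌉ 5))))

lemma2 : (g D n L ℓ : ℕ) → ℓ ≤ L → (B : List (Fin g)) → length B ≤ n →
    (F : List (Pair g → Fin ((5 * ⌈log₂ n ⌉) * D))) → F ≢ [] → PairwiseIndependent F →
    n ^ 3 * count (λ hs → all? (λ Bj → length (Dict Bj) ≤? 5 * D * ⌈log₂ n ⌉) (Split hs B)) (tuples F (5 * ⌈log₂ n ⌉))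
      + length F ^ (5 * ⌈log₂ n ⌉)
      ≥ n ^ 3 * length F ^ (5 * ⌈log₂ n ⌉)
-- The level ℓ only selects which hash function is drawn, so the bound is uniform in it.
lemma2 g D n _ _ _ B |B|≤n F F≢[] indep = begin
  n ^ 3 * length F ^ m                  ≡⟨ cong (n ^ 3 *_) (trans (count-complement light? T) (length-tuples F m)) ⟨
  n ^ 3 * (light + heavy)               ≡⟨ *-distribˡ-+ (n ^ 3) light heavy ⟩
  n ^ 3 * light + n ^ 3 * heavy         ≤⟨ +-monoʳ-≤ (n ^ 3 * light) (heavy-tuples-bound F F≢[] indep r≢1 r≤K {m = m} B |B|≤n (n^5≤2^[5*⌈log₂n⌉] n)) ⟩
  n ^ 3 * light + length F ^ m          ∎
  where
  open ≤-Reasoning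
  c = ⌈log₂ n ⌉
  m = 5 * c
  T = tuples F m
  light? : (hs : List (Pair g → Fin (5 * c * D))) → Dec (All (λ Bj → length (Dict Bj) ≤ 5 * D * c) (Split hs B))
  light? hs = all? (λ Bj → length (Dict Bj) ≤? 5 * D * c) (Split hs B)
  light = count light? T
  heavy = count (¬? ∘ light?) T
  r≢1 : 5 * c * D ≢ 1
  r≢1 r≡1 with m*n≡1⇒m≡1 5 c (m*n≡1⇒m≡1 (5 * c) D r≡1)
  ... | ()
  r≤K : 5 * c * D ≤ 5 * D * c
  r≤K = ≤-reflexive (trans (*-assoc 5 c D) (trans (cong (5 *_) (*-comm c D)) (sym (*-assoc 5 D c))))
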